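{- Let $H$ be an induced subgraph of a graph $G$. Suppose there is no independent set $I\subseteq V(H)$ that has a dominating vertex in $G$ but no dominating vertex in $H$. Then $\chi_{cd}(G)\geq\chi_{cd}(H)$.
   Context: For a graph $F$, an independent set $I$ has a dominating vertex in $F$ if there is $v\in V(F)$ with $I\subseteq N_F(v)$. A cd-colouring of $F$ is a proper colouring in which every colour class has a dominating vertex in $F$; $\chi_{cd}(F)$ is the minimum number of colours of a cd-colouring of $F$. -}

module Defs where

open import Data.Nat using (ℕ; _<_)
open import Data.Fin using (Fin)
open import Data.Product using (Σ; ∃; _×_)
open import Relation.Binary.PropositionalEquality using (_≡_; _≢_)
open import Relation.Nullary using (¬_)
open import Function.Definitions using (Injective)
open import Function.Bundles using (_⇔_)
open import Level using (0ℓ)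
open import Relation.Unary using (Pred; _∈_)

record Graph : Set₁ where
  field
    n      : ℕ
    Adj    : Fin n → Fin n → Set
    sym    : ∀ {u v} → Adj u v → Adj v u
    irrefl : ∀ {v} → ¬ Adj v v

open Graph public

VSet : Graph → Set₁
VSet F = Pred (Fin (n F)) 0ℓ

Independent : (F : Graph) → VSet F → Set
Independent F I = ∀ u v → u ∈ I → v ∈ I → ¬ Adj F u v

HasDominatingVertex : (F : Graph) → VSet F → Set
HasDominatingVertex F I = ∃ λ v → ∀ u → u ∈ I → Adj F v u

record InducedSubgraph (H G : Graph) : Set where
  field
    emb     : Fin (n H) → Fin (n G)
    emb-inj : Injective _≡_ _≡_ emb
    emb-adj : ∀ u v → Adj H u v ⇔ Adj G (emb u) (emb v)

open InducedSubgraph public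

image : ∀ {H G} → InducedSubgraph H G → VSet H → VSet G
image {H} e I w = ∃ λ u → u ∈ I × emb e u ≡ w

ColourClass : (F : Graph) {k : ℕ} → (Fin (n F) → Fin k) → Fin k → VSet F
ColourClass F c i u = c u ≡ i

record CdColouring (F : Graph) (k : ℕ) : Set where
  field
    colour    : Fin (n F) → Fin k
    proper    : ∀ u v → Adj F u v → colour u ≢ colour v
    dominated : ∀ i → HasDominatingVertex F (ColourClass F colour i)

IsChiCd : Graph → ℕ → Set
IsChiCd F k = CdColouring F k × (∀ j → j < k → ¬ CdColouring F j)

{-# OPTIONS --safe #-}
module Submission where

open import Defs
open import Data.Nat using (ℕ; _≥_)
open import Data.Nat.Properties using (≮⇒≥)
open import Data.Product using (_,_)
open import Function.Base using (_∘_)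
open import Function.Bundles using (Equivalence)
open import Relation.Binary.PropositionalEquality as ≡ using (refl; trans)

-- A cd-colouring of G restricts to one of H: each restricted colour class is
-- independent and its image is dominated in G, and the hypothesis moves that
-- domination into H.

module _ {H G : Graph} (e : InducedSubgraph H G) where

  emb-preserves-adj : ∀ {u v} → Adj H u v → Adj G (emb e u) (emb e v)
  emb-preserves-adj {u} {v} = Equivalence.to (emb-adj e u v)

  colourClass-restrict-independent :
    ∀ {k} (c : CdColouring G k) i →
    Independent H (ColourClass H (CdColouring.colour c ∘ emb e) i)
  colourClass-restrict-independent c i u v cu cv uv =
    CdColouring.proper c (emb e u) (emb e v) (emb-preserves-adj uv) (trans cu (≡.sym cv))

  image-colourClass-restrict-dominated :
    ∀ {k} (c : CdColouring G k) i →
    HasDominatingVertex G (image e (ColourClass H (CdColouring.colour c ∘ emb e) i))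
  image-colourClass-restrict-dominated c i with CdColouring.dominated c i
  ... | v , v-dom = v , λ { _ (u , cu , refl) → v-dom (emb e u) cu }

  restrictCdColouring :
    (∀ (I : VSet H) → Independent H I →
       HasDominatingVertex G (image e I) → HasDominatingVertex H I) →
    ∀ {k} → CdColouring G k → CdColouring H k
  restrictCdColouring transfer c = record
    { colour    = CdColouring.colour c ∘ emb e
    ; proper    = λ u v uv → CdColouring.proper c (emb e u) (emb e v) (emb-preserves-adj uv)
    ; dominated = λ i → transfer _ (colourClass-restrict-independent c i)
                                   (image-colourClass-restrict-dominated c i)
    }

mainTheorem17 : (G H : Graph) (e : InducedSubgraph H G) →
    (∀ (I : VSet H) → Independent H I →
       HasDominatingVertex G (image e I) → HasDominatingVertex H I) →
    (a b : ℕ) → IsChiCd G a → IsChiCd H b → a ≥ b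
mainTheorem17 G H e transfer a b (colouringG , _) (_ , minimalH) =
  ≮⇒≥ λ a<b → minimalH a a<b (restrictCdColouring e transfer colouringG)
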